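{- Let $n$ be even and let $N, M \in \mathcal{M}_n$ be such that $N$ is a switch of $M$. Then (a) $\phi(N)<\phi(M)$, and (b) $N \preceq M$.
   Context: All graphs are simple. $\mathcal{M}_n$ is the set of perfect matchings of the complete graph $K_n$ on vertex set $[n]$; $(i,j)$ denotes the edge between $i$ and $j$. For a weakly decreasing sequence $(d_1,\ldots,d_n)$ of non-negative integers and $M\in\mathcal{M}_n$, the sequence can realize $M$ if there is a graph $G$ on $[n]$ with $\deg_G(i)=d_i$ for all $i$ and $M\subseteq E(G)$. For $N,M\in\mathcal{M}_n$, write $N\preceq M$ if every such sequence $(d_1,\ldots,d_n)$ which can realize $M$ can also realize $N$. $N$ is a switch of $M$ if the symmetric difference $M\triangle N$ is a single 4-cycle on vertices $w<x<y<z$ of $[n]$ and one of the following holds: (1) $M\setminus N=\{(w,x),(y,z)\}$ and $N\setminus M=\{(w,y),(x,z)\}$; (2) $M\setminus N=\{(w,y),(x,z)\}$ and $N\setminus M=\{(w,z),(x,y)\}$; (3) $M\setminus N=\{(w,x),(y,z)\}$ and $N\setminus M=\{(w,z),(x,y)\}$. For a matching $M$ on $[n]$, $\phi(M)=\sum_{(u,v)\in M}2^{u+v}$. -}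

module Defs where

open import Data.Nat using (ℕ; zero; suc; _+_; _^_; _≤_; _<_)
open import Data.Bool using (Bool; true; false; _∧_; _∨_; not; if_then_else_)
open import Data.Fin using (Fin; toℕ; _≟_) renaming (zero to fzero; suc to fsuc)
open import Data.Product using (Σ; ∃; _×_; _,_)
open import Data.Sum using (_⊎_)
open import Relation.Nullary.Decidable using (⌊_⌋)
open import Relation.Binary.PropositionalEquality using (_≡_)

sumFin : ∀ {n} → (Fin n → ℕ) → ℕ
sumFin {zero} f = 0
sumFin {suc n} f = f fzero + sumFin (λ i → f (fsuc i))

-- 1-based label of a vertex: vertex set is [n] = {1,…,n}, Fin n index i ↦ i+1
label : ∀ {n} → Fin n → ℕ
label i = suc (toℕ i)

record Graph (n : ℕ) : Set where
  field
    adj    : Fin n → Fin n → Bool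
    sym    : ∀ i j → adj i j ≡ adj j i
    irrefl : ∀ i → adj i i ≡ false
open Graph public

deg : ∀ {n} → Graph n → Fin n → ℕ
deg G i = sumFin (λ j → if adj G i j then 1 else 0)

record PerfectMatching (n : ℕ) : Set where
  field
    graph   : Graph n
    regular : ∀ i → deg graph i ≡ 1
open PerfectMatching public

E : ∀ {n} → PerfectMatching n → Fin n → Fin n → Bool
E M = adj (graph M)

WeaklyDecreasing : ∀ {n} → (Fin n → ℕ) → Set
WeaklyDecreasing {n} d = ∀ (i j : Fin n) → toℕ i ≤ toℕ j → d j ≤ d i

CanRealize : ∀ {n} → (Fin n → ℕ) → PerfectMatching n → Set
CanRealize {n} d M =
  Σ (Graph n) λ G → (∀ i → deg G i ≡ d i) × (∀ a b → E M a b ≡ true → adj G a b ≡ true)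

_⪯_ : ∀ {n} → PerfectMatching n → PerfectMatching n → Set
_⪯_ {n} N M = ∀ (d : Fin n → ℕ) → WeaklyDecreasing d → CanRealize d M → CanRealize d N

isEdge : ∀ {n} → Fin n → Fin n → Fin n → Fin n → Bool
isEdge a b p q = (⌊ a ≟ p ⌋ ∧ ⌊ b ≟ q ⌋) ∨ (⌊ a ≟ q ⌋ ∧ ⌊ b ≟ p ⌋)

twoEdges : ∀ {n} → Fin n → Fin n → Fin n → Fin n → Fin n → Fin n → Bool
twoEdges a b p q r s = isEdge a b p q ∨ isEdge a b r s

SwitchShape : ∀ {n} → PerfectMatching n → PerfectMatching n →
  (p q r s p' q' r' s' : Fin n) → Set
SwitchShape N M p q r s p' q' r' s' =
  (∀ a b → (E M a b ∧ not (E N a b)) ≡ twoEdges a b p q r s) ×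
  (∀ a b → (E N a b ∧ not (E M a b)) ≡ twoEdges a b p' q' r' s')

IsSwitch : ∀ {n} → PerfectMatching n → PerfectMatching n → Set
IsSwitch {n} N M =
  Σ (Fin n) λ w → Σ (Fin n) λ x → Σ (Fin n) λ y → Σ (Fin n) λ z →
    (toℕ w < toℕ x) × (toℕ x < toℕ y) × (toℕ y < toℕ z) ×
    ( SwitchShape N M w x y z  w y x z
    ⊎ SwitchShape N M w y x z  w z x y
    ⊎ SwitchShape N M w x y z  w z x y )

φ : ∀ {n} → PerfectMatching n → ℕ
φ M = sumFin λ u → sumFin λ v →
  if E M u v ∧ ⌊ toℕ u Data.Nat.<? toℕ v ⌋ then 2 ^ (label u + label v) else 0
  where import Data.Nat

-- A switch trades two edges of M for two edges of N on the same four vertices w < x < y < z.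
-- (a) φ M − φ N is the weight of the two removed edges minus that of the two added ones; in each of the three
-- switch types both added exponents lie below the larger removed exponent m, and 2^i + 2^j ≤ 2^m for i, j < m.
-- (b) Write M ∖ N = {ab, cd} and N ∖ M = {ac, bd}, labelled so that d_c ≤ d_b and d_d ≤ d_a, and let G realize d
-- with M ⊆ G. If G has neither ac nor bd, the degree-preserving switch {ab, cd} → {ac, bd} gives a realization
-- containing N. If G has ac but not bd, then d is a neighbour of c but not of b, so deg c ≤ deg b yields a
-- neighbour u ≠ c of b not adjacent to c; the switch {cd, ub} → {cu, db} adds bd and keeps every edge of N,
-- as u is not the N-partner d of b.

module Submission where

open import Defs
open import Algebra.Properties.CommutativeSemigroup using (interchange)
open import Data.Bool using (Bool; true; false; _∧_; _∨_; not; if_then_else_) renaming (_≟_ to _≟ᵇ_)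
open import Data.Bool.Properties using (T-≡; ∧-distribʳ-∨; ∧-comm; ∧-identityʳ; ∧-zeroʳ; ∨-comm; ∨-zeroʳ)
open import Data.Fin using (Fin; toℕ; _≟_) renaming (zero to fzero; suc to fsuc)
open import Data.Fin.Properties using (any?; <⇒≢)
open import Data.Nat using (ℕ; zero; suc; _+_; _^_; _≤_; _<_; _%_; z≤n; s≤s; _<?_)
open import Data.Nat.Properties
  using ( +-commutativeSemigroup; +-comm; +-identityʳ; ≤-refl; ≤-reflexive; <⇒≤; <⇒≱; <-trans
        ; +-mono-≤; +-mono-<; +-mono-<-≤; +-monoˡ-<; +-monoʳ-<; +-cancelʳ-≡; +-cancelʳ-<
        ; m<m+n; m<n+m; m^n>0; ^-monoʳ-≤; module ≤-Reasoning )
open import Data.Product using (∃; _×_; _,_; proj₁; proj₂)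
open import Data.Empty using (⊥)
open import Data.Sum using (_⊎_; inj₁; inj₂)
import Data.Sum as Sum
open import Function using (_∘_; Equivalence)
open import Relation.Nullary using (¬_; yes; no; contradiction)
open import Relation.Nullary.Decidable using (⌊_⌋; isYes≗does; dec-true; dec-false; toWitness; _×-dec_; ¬?)
open import Relation.Binary.PropositionalEquality
  using (_≡_; _≢_; refl; trans; cong; cong₂; subst; subst₂; ≢-sym; module ≡-Reasoning) renaming (sym to ≡-sym)

variable
  n : ℕ

⟦_⟧·_ : Bool → ℕ → ℕ
⟦ b ⟧· k = if b then k else 0

⟦_⟧ : Bool → ℕ
⟦ b ⟧ = ⟦ b ⟧· 1

true≢false : true ≢ false
true≢false ()

≢true⇒≡false : ∀ {x} → x ≢ true → x ≡ false
≢true⇒≡false {false} _ = refl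
≢true⇒≡false {true} x≢true = contradiction refl x≢true

∧-true : ∀ {x y} → x ∧ y ≡ true → x ≡ true × y ≡ true
∧-true {true} {true} _ = refl , refl

∧-not-true : ∀ {x y} → x ∧ not y ≡ true → x ≡ true × y ≡ false
∧-not-true {true} {false} _ = refl , refl

∨-true : ∀ {x y} → x ∨ y ≡ true → x ≡ true ⊎ y ≡ true
∨-true {true} _ = inj₁ refl
∨-true {false} y≡true = inj₂ y≡true

∨∧-select : ∀ x y l → (x ≡ true → l ≡ true) → (y ≡ true → l ≡ false) → (x ∨ y) ∧ l ≡ x
∨∧-select true _ l x⇒l _ rewrite x⇒l refl = refl
∨∧-select false true l _ y⇒¬l rewrite y⇒¬l refl = refl
∨∧-select false false _ _ _ = refl

⟦⟧·-∨ : ∀ x y k → (x ≡ true → y ≡ false) → ⟦ x ∨ y ⟧· k ≡ ⟦ x ⟧· k + ⟦ y ⟧· k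
⟦⟧·-∨ true y k exclusive rewrite exclusive refl = ≡-sym (+-identityʳ k)
⟦⟧·-∨ false _ _ _ = refl

⟦⟧·-exchange : ∀ r s l k → ⟦ r ∧ l ⟧· k + ⟦ (s ∧ not r) ∧ l ⟧· k ≡ ⟦ s ∧ l ⟧· k + ⟦ (r ∧ not s) ∧ l ⟧· k
⟦⟧·-exchange true true _ _ = refl
⟦⟧·-exchange true false l k = +-comm (⟦ l ⟧· k) 0
⟦⟧·-exchange false true l k = ≡-sym (+-identityʳ (⟦ l ⟧· k))
⟦⟧·-exchange false false _ _ = refl

-- Degree preservation of a switch, pointwise: p₁, p₂ are the added pairs and q₁, q₂ the removed ones.
exchange-count : ∀ p₁ p₂ q₁ q₂ g →
  (q₁ ≡ true → g ≡ true) → (q₂ ≡ true → g ≡ true) → (p₁ ≡ true → g ≡ false) → (p₂ ≡ true → g ≡ false) →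
  (p₁ ≡ true → p₂ ≡ false) → (q₁ ≡ true → q₂ ≡ false) →
  ⟦ if p₁ ∨ p₂ then true else if q₁ ∨ q₂ then false else g ⟧ + (⟦ q₁ ⟧ + ⟦ q₂ ⟧) ≡ ⟦ g ⟧ + (⟦ p₁ ⟧ + ⟦ p₂ ⟧)
exchange-count true  _     _     _     true  _  _  p₁ _  _ _ = contradiction (p₁ refl) true≢false
exchange-count false true  _     _     true  _  _  _  p₂ _ _ = contradiction (p₂ refl) true≢false
exchange-count false false false false true  _  _  _  _  _ _ = refl
exchange-count false false true  false true  _  _  _  _  _ _ = refl
exchange-count false false false true  true  _  _  _  _  _ _ = refl
exchange-count false false true  true  true  _  _  _  _  _ q = contradiction (q refl) true≢false
exchange-count _     _     true  _     false q₁ _  _  _  _ _ = contradiction (≡-sym (q₁ refl)) true≢false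
exchange-count _     _     false true  false _  q₂ _  _  _ _ = contradiction (≡-sym (q₂ refl)) true≢false
exchange-count false false false false false _  _  _  _  _ _ = refl
exchange-count true  false false false false _  _  _  _  _ _ = refl
exchange-count false true  false false false _  _  _  _  _ _ = refl
exchange-count true  true  false false false _  _  _  _  p _ = contradiction (p refl) true≢false

≟-true : {i j : Fin n} → ⌊ i ≟ j ⌋ ≡ true → i ≡ j
≟-true e = toWitness (Equivalence.from T-≡ e)

≟-false : {i j : Fin n} → i ≢ j → ⌊ i ≟ j ⌋ ≡ false
≟-false {i = i} {j} i≢j = trans (isYes≗does (i ≟ j)) (dec-false (i ≟ j) i≢j)

≟-refl : (i : Fin n) → ⌊ i ≟ i ⌋ ≡ true
≟-refl i = trans (isYes≗does (i ≟ i)) (dec-true (i ≟ i) refl)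

≟-fsuc : (i j : Fin n) → ⌊ fsuc i ≟ fsuc j ⌋ ≡ ⌊ i ≟ j ⌋
≟-fsuc i j with i ≟ j
... | yes _ = refl
... | no _ = refl

<?-true : {u v : Fin n} → toℕ u < toℕ v → ⌊ toℕ u <? toℕ v ⌋ ≡ true
<?-true {u = u} {v} u<v = trans (isYes≗does (toℕ u <? toℕ v)) (dec-true (toℕ u <? toℕ v) u<v)

<?-false : {u v : Fin n} → toℕ v < toℕ u → ⌊ toℕ u <? toℕ v ⌋ ≡ false
<?-false {u = u} {v} v<u = trans (isYes≗does (toℕ u <? toℕ v)) (dec-false (toℕ u <? toℕ v) (<⇒≱ v<u ∘ <⇒≤))

≟∧≟-true : (i j : Fin n) {a b : Fin n} → ⌊ i ≟ a ⌋ ∧ ⌊ j ≟ b ⌋ ≡ true → i ≡ a × j ≡ b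
≟∧≟-true _ _ e = ≟-true (proj₁ (∧-true e)) , ≟-true (proj₂ (∧-true e))

≟∧≟-exclusive : (i j : Fin n) {p q r s : Fin n} → p ≢ r →
  ⌊ i ≟ p ⌋ ∧ ⌊ j ≟ q ⌋ ≡ true → ⌊ i ≟ r ⌋ ∧ ⌊ j ≟ s ⌋ ≡ false
≟∧≟-exclusive i j p≢r e =
  ≢true⇒≡false λ e′ → p≢r (trans (≡-sym (proj₁ (≟∧≟-true i j e))) (proj₁ (≟∧≟-true i j e′)))

sumFin-cong : {f g : Fin n → ℕ} → (∀ i → f i ≡ g i) → sumFin f ≡ sumFin g
sumFin-cong {zero} _ = refl
sumFin-cong {suc n} f≗g = cong₂ _+_ (f≗g fzero) (sumFin-cong (f≗g ∘ fsuc))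

sumFin-+ : (f g : Fin n → ℕ) → sumFin (λ i → f i + g i) ≡ sumFin f + sumFin g
sumFin-+ {zero} _ _ = refl
sumFin-+ {suc n} f g = trans (cong (f fzero + g fzero +_) (sumFin-+ (f ∘ fsuc) (g ∘ fsuc)))
  (interchange +-commutativeSemigroup (f fzero) (g fzero) (sumFin (f ∘ fsuc)) (sumFin (g ∘ fsuc)))

sumFin-+₃ : (f g h : Fin n → ℕ) → sumFin (λ i → f i + (g i + h i)) ≡ sumFin f + (sumFin g + sumFin h)
sumFin-+₃ f g h = trans (sumFin-+ f _) (cong (sumFin f +_) (sumFin-+ g h))

sumFin²-+ : (f g : Fin n → Fin n → ℕ) →
  sumFin (λ u → sumFin (λ v → f u v + g u v)) ≡ sumFin (λ u → sumFin (f u)) + sumFin (λ u → sumFin (g u))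
sumFin²-+ f g =
  trans (sumFin-cong (λ u → sumFin-+ (f u) (g u))) (sumFin-+ (λ u → sumFin (f u)) (λ u → sumFin (g u)))

sumFin-mono : {f g : Fin n → ℕ} → (∀ i → f i ≤ g i) → sumFin f ≤ sumFin g
sumFin-mono {zero} _ = z≤n
sumFin-mono {suc n} f≤g = +-mono-≤ (f≤g fzero) (sumFin-mono (f≤g ∘ fsuc))

sumFin-zero : sumFin {n} (λ _ → 0) ≡ 0
sumFin-zero {zero} = refl
sumFin-zero {suc n} = sumFin-zero {n}

sumFin-point : (q : Fin n) (f : Fin n → ℕ) → sumFin (λ v → ⟦ ⌊ v ≟ q ⌋ ⟧· f v) ≡ f q
sumFin-point {suc n} fzero f = trans (cong (f fzero +_) (sumFin-zero {n})) (+-identityʳ (f fzero))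
sumFin-point {suc n} (fsuc q) f =
  trans (sumFin-cong λ v → cong (⟦_⟧· f (fsuc v)) (≟-fsuc v q)) (sumFin-point q (f ∘ fsuc))

sumFin-indicator : (x : Bool) (q : Fin n) (f : Fin n → ℕ) →
  sumFin (λ v → ⟦ x ∧ ⌊ v ≟ q ⌋ ⟧· f v) ≡ ⟦ x ⟧· f q
sumFin-indicator true q f = sumFin-point q f
sumFin-indicator {n} false _ _ = sumFin-zero {n}

sumFin²-point : (p q : Fin n) (f : Fin n → Fin n → ℕ) →
  sumFin (λ u → sumFin (λ v → ⟦ ⌊ u ≟ p ⌋ ∧ ⌊ v ≟ q ⌋ ⟧· f u v)) ≡ f p q
sumFin²-point p q f = trans (sumFin-cong λ u → sumFin-indicator ⌊ u ≟ p ⌋ q (f u)) (sumFin-point p (λ u → f u q))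

isEdge-true : (i j : Fin n) {a b : Fin n} → isEdge i j a b ≡ true → (i ≡ a × j ≡ b) ⊎ (i ≡ b × j ≡ a)
isEdge-true i j e = Sum.map (≟∧≟-true i j) (≟∧≟-true i j) (∨-true e)

isEdge-self : (a b : Fin n) → isEdge a b a b ≡ true
isEdge-self a b rewrite ≟-refl a | ≟-refl b = refl

isEdge-swap : (i j a b : Fin n) → isEdge i j a b ≡ isEdge i j b a
isEdge-swap i j a b = ∨-comm (⌊ i ≟ a ⌋ ∧ ⌊ j ≟ b ⌋) (⌊ i ≟ b ⌋ ∧ ⌊ j ≟ a ⌋)

isEdge-sym : (i j a b : Fin n) → isEdge i j a b ≡ isEdge j i a b
isEdge-sym i j a b = trans (cong₂ _∨_ (∧-comm ⌊ i ≟ a ⌋ ⌊ j ≟ b ⌋) (∧-comm ⌊ i ≟ b ⌋ ⌊ j ≟ a ⌋))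
                           (∨-comm (⌊ j ≟ b ⌋ ∧ ⌊ i ≟ a ⌋) (⌊ j ≟ a ⌋ ∧ ⌊ i ≟ b ⌋))

isEdge-diag : {a b : Fin n} (i : Fin n) → a ≢ b → isEdge i i a b ≡ false
isEdge-diag i a≢b = ≢true⇒≡false λ e → a≢b (Sum.[ same , ≡-sym ∘ same ]′ (isEdge-true i i e))
  where
  same : {x y : Fin _} → i ≡ x × i ≡ y → x ≡ y
  same (refl , refl) = refl

isEdge-disjoint : (i j : Fin n) {p q r s : Fin n} →
  isEdge i j p q ≡ true → isEdge i j r s ≡ true → p ≢ r → p ≢ s → ⊥
isEdge-disjoint i j e e′ p≢r p≢s with isEdge-true i j e | isEdge-true i j e′
... | inj₁ (refl , _) | inj₁ (refl , _) = p≢r refl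
... | inj₁ (refl , _) | inj₂ (refl , _) = p≢s refl
... | inj₂ (_ , refl) | inj₁ (_ , refl) = p≢s refl
... | inj₂ (_ , refl) | inj₂ (_ , refl) = p≢r refl

adj-isEdge : (H : Graph n) {i j a b : Fin n} → isEdge i j a b ≡ true → adj H i j ≡ adj H a b
adj-isEdge H {i} {j} e with isEdge-true i j e
... | inj₁ (refl , refl) = refl
... | inj₂ (refl , refl) = sym H _ _

isEdge-nonedge : (H : Graph n) {i j a b : Fin n} →
  adj H i j ≡ true → adj H a b ≡ false → isEdge i j a b ≡ false
isEdge-nonedge H ij ¬ab = ≢true⇒≡false λ e → true≢false (trans (≡-sym ij) (trans (adj-isEdge H e) ¬ab))

adj-≢ : (G : Graph n) {x u v : Fin n} → adj G x u ≡ true → adj G x v ≡ false → u ≢ v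
adj-≢ G xu ¬xv refl = true≢false (trans (≡-sym xu) ¬xv)

adj⇒≢ : (G : Graph n) {x u : Fin n} → adj G x u ≡ true → x ≢ u
adj⇒≢ G xu = ≢-sym (adj-≢ G xu (irrefl G _))

sumFin-isEdge : (i a b : Fin n) → a ≢ b →
  sumFin (λ j → ⟦ isEdge i j a b ⟧) ≡ ⟦ ⌊ i ≟ a ⌋ ⟧ + ⟦ ⌊ i ≟ b ⌋ ⟧
sumFin-isEdge i a b a≢b = begin
  sumFin (λ j → ⟦ isEdge i j a b ⟧)
    ≡⟨ sumFin-cong (λ j → ⟦⟧·-∨ (⌊ i ≟ a ⌋ ∧ ⌊ j ≟ b ⌋) _ 1 (≟∧≟-exclusive i j a≢b)) ⟩
  sumFin (λ j → ⟦ ⌊ i ≟ a ⌋ ∧ ⌊ j ≟ b ⌋ ⟧ + ⟦ ⌊ i ≟ b ⌋ ∧ ⌊ j ≟ a ⌋ ⟧)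
    ≡⟨ sumFin-+ (λ j → ⟦ ⌊ i ≟ a ⌋ ∧ ⌊ j ≟ b ⌋ ⟧) (λ j → ⟦ ⌊ i ≟ b ⌋ ∧ ⌊ j ≟ a ⌋ ⟧) ⟩
  sumFin (λ j → ⟦ ⌊ i ≟ a ⌋ ∧ ⌊ j ≟ b ⌋ ⟧) + sumFin (λ j → ⟦ ⌊ i ≟ b ⌋ ∧ ⌊ j ≟ a ⌋ ⟧)
    ≡⟨ cong₂ _+_ (sumFin-indicator ⌊ i ≟ a ⌋ b (λ _ → 1)) (sumFin-indicator ⌊ i ≟ b ⌋ a (λ _ → 1)) ⟩
  ⟦ ⌊ i ≟ a ⌋ ⟧ + ⟦ ⌊ i ≟ b ⌋ ⟧ ∎
  where open ≡-Reasoning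

record Rewiring (G : Graph n) (Kept : Fin n → Fin n → Set) (p q r s : Fin n) : Set where
  field
    graph′   : Graph n
    deg-same : ∀ i → deg graph′ i ≡ deg G i
    has-pq   : adj graph′ p q ≡ true
    has-rs   : adj graph′ r s ≡ true
    keeps    : ∀ i j → adj G i j ≡ true → Kept i j → adj graph′ i j ≡ true

Rewiring-swap : {G : Graph n} {K : Fin n → Fin n → Set} {p q r s : Fin n} →
  Rewiring G K p q r s → Rewiring G K r s p q
Rewiring-swap R = record { Rewiring R renaming (has-pq to has-rs; has-rs to has-pq) }

Rewiring-mono : {G : Graph n} {K K′ : Fin n → Fin n → Set} {p q r s : Fin n} →
  (∀ {i j} → K i j → K′ i j) → Rewiring G K′ p q r s → Rewiring G K p q r s
Rewiring-mono K⇒K′ R = record { Rewiring R hiding (keeps) ; keeps = λ i j Gij Kij → keeps i j Gij (K⇒K′ Kij) }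
  where open Rewiring R using (keeps)

module _ (G : Graph n) {a b c d : Fin n} (a≢c : a ≢ c) (b≢d : b ≢ d)
         (ab : adj G a b ≡ true) (cd : adj G c d ≡ true) (¬ac : adj G a c ≡ false) (¬bd : adj G b d ≡ false) where

  private
    switchAdj : Fin n → Fin n → Bool
    switchAdj i j = if isEdge i j a c ∨ isEdge i j b d then true
                    else if isEdge i j a b ∨ isEdge i j c d then false
                    else adj G i j

    switchAdj-sym : ∀ i j → switchAdj i j ≡ switchAdj j i
    switchAdj-sym i j rewrite isEdge-sym i j a c | isEdge-sym i j b d | isEdge-sym i j a b | isEdge-sym i j c d
                            | sym G i j = refl

    switchAdj-irrefl : ∀ i → switchAdj i i ≡ false
    switchAdj-irrefl i rewrite isEdge-diag i a≢c | isEdge-diag i b≢d with isEdge i i a b ∨ isEdge i i c d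
    ... | true = refl
    ... | false = irrefl G i

    switched : Graph n
    switched = record { adj = switchAdj ; sym = switchAdj-sym ; irrefl = switchAdj-irrefl }

    a≢b : a ≢ b
    a≢b = adj⇒≢ G ab

    c≢d : c ≢ d
    c≢d = adj⇒≢ G cd

    a≢d : a ≢ d
    a≢d = ≢-sym (adj-≢ G cd (trans (sym G c a) ¬ac))

    count : ∀ i j → ⟦ switchAdj i j ⟧ + (⟦ isEdge i j a b ⟧ + ⟦ isEdge i j c d ⟧)
                  ≡ ⟦ adj G i j ⟧ + (⟦ isEdge i j a c ⟧ + ⟦ isEdge i j b d ⟧)
    count i j = exchange-count (isEdge i j a c) (isEdge i j b d) (isEdge i j a b) (isEdge i j c d) (adj G i j)
      (λ e → trans (adj-isEdge G e) ab) (λ e → trans (adj-isEdge G e) cd)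
      (λ e → trans (adj-isEdge G e) ¬ac) (λ e → trans (adj-isEdge G e) ¬bd)
      (λ e → ≢true⇒≡false λ e′ → isEdge-disjoint i j e e′ a≢b a≢d)
      (λ e → ≢true⇒≡false λ e′ → isEdge-disjoint i j e e′ a≢c a≢d)

    deg-switched : ∀ i → deg switched i ≡ deg G i
    deg-switched i = +-cancelʳ-≡ (row a b + row c d) (deg switched i) (deg G i) (begin
      deg switched i + (row a b + row c d)
        ≡⟨ sumFin-+₃ (λ j → ⟦ switchAdj i j ⟧) (λ j → ⟦ isEdge i j a b ⟧) (λ j → ⟦ isEdge i j c d ⟧) ⟨
      sumFin (λ j → ⟦ switchAdj i j ⟧ + (⟦ isEdge i j a b ⟧ + ⟦ isEdge i j c d ⟧))
        ≡⟨ sumFin-cong (count i) ⟩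
      sumFin (λ j → ⟦ adj G i j ⟧ + (⟦ isEdge i j a c ⟧ + ⟦ isEdge i j b d ⟧))
        ≡⟨ sumFin-+₃ (λ j → ⟦ adj G i j ⟧) (λ j → ⟦ isEdge i j a c ⟧) (λ j → ⟦ isEdge i j b d ⟧) ⟩
      deg G i + (row a c + row b d)
        ≡⟨ cong (deg G i +_) rows ⟩
      deg G i + (row a b + row c d) ∎)
      where
      open ≡-Reasoning
      row : Fin _ → Fin _ → ℕ
      row x y = sumFin (λ j → ⟦ isEdge i j x y ⟧)
      at : Fin _ → ℕ
      at x = ⟦ ⌊ i ≟ x ⌋ ⟧
      rows : row a c + row b d ≡ row a b + row c d
      rows = begin
        row a c + row b d           ≡⟨ cong₂ _+_ (sumFin-isEdge i a c a≢c) (sumFin-isEdge i b d b≢d) ⟩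
        at a + at c + (at b + at d) ≡⟨ interchange +-commutativeSemigroup (at a) (at c) (at b) (at d) ⟩
        at a + at b + (at c + at d) ≡⟨ cong₂ _+_ (sumFin-isEdge i a b a≢b) (sumFin-isEdge i c d c≢d) ⟨
        row a b + row c d ∎

    keeps-others : ∀ i j → adj G i j ≡ true → isEdge i j a b ≡ false × isEdge i j c d ≡ false →
                   switchAdj i j ≡ true
    keeps-others i j gij (not-ab , not-cd) rewrite not-ab | not-cd | gij with isEdge i j a c ∨ isEdge i j b d
    ... | true = refl
    ... | false = refl

    has-ac : switchAdj a c ≡ true
    has-ac rewrite isEdge-self a c = refl

    has-bd : switchAdj b d ≡ true
    has-bd rewrite isEdge-self b d | ∨-zeroʳ (isEdge b d a c) = refl

  switch : Rewiring G (λ i j → isEdge i j a b ≡ false × isEdge i j c d ≡ false) a c b d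
  switch = record
    { graph′ = switched
    ; deg-same = deg-switched
    ; has-pq = has-ac
    ; has-rs = has-bd
    ; keeps = keeps-others
    }

deg-except : Graph n → Fin n → Fin n → ℕ
deg-except G x y = sumFin (λ u → ⟦ adj G x u ∧ not ⌊ u ≟ y ⌋ ⟧)

deg-split : (G : Graph n) (x y : Fin n) → deg G x ≡ deg-except G x y + ⟦ adj G x y ⟧
deg-split G x y = begin
  deg G x
    ≡⟨ sumFin-cong split ⟩
  sumFin (λ u → ⟦ adj G x u ∧ not ⌊ u ≟ y ⌋ ⟧ + ⟦ adj G x y ∧ ⌊ u ≟ y ⌋ ⟧)
    ≡⟨ sumFin-+ (λ u → ⟦ adj G x u ∧ not ⌊ u ≟ y ⌋ ⟧) (λ u → ⟦ adj G x y ∧ ⌊ u ≟ y ⌋ ⟧) ⟩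
  deg-except G x y + sumFin (λ u → ⟦ adj G x y ∧ ⌊ u ≟ y ⌋ ⟧)
    ≡⟨ cong (deg-except G x y +_) (sumFin-indicator (adj G x y) y (λ _ → 1)) ⟩
  deg-except G x y + ⟦ adj G x y ⟧ ∎
  where
  open ≡-Reasoning
  split : ∀ u → ⟦ adj G x u ⟧ ≡ ⟦ adj G x u ∧ not ⌊ u ≟ y ⌋ ⟧ + ⟦ adj G x y ∧ ⌊ u ≟ y ⌋ ⟧
  split u with u ≟ y
  ... | yes refl rewrite ∧-zeroʳ (adj G x u) | ∧-identityʳ (adj G x u) = refl
  ... | no _ rewrite ∧-identityʳ (adj G x u) | ∧-zeroʳ (adj G x y) = ≡-sym (+-identityʳ ⟦ adj G x u ⟧)

module _ (G : Graph n) {b c d : Fin n} (b≢d : b ≢ d) (cd : adj G c d ≡ true) (¬bd : adj G b d ≡ false) where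

  private
    Unshared : Fin n → Set
    Unshared u = adj G b u ≡ true × adj G c u ≡ false × u ≢ c

    -- Without an unshared neighbour, N(b) ∖ {c} ⊆ N(c) ∖ {b}, and d witnesses that the inclusion is strict.
    count : ¬ ∃ Unshared →
      ∀ u → ⟦ adj G b u ∧ not ⌊ u ≟ c ⌋ ⟧ + ⟦ ⌊ u ≟ d ⌋ ⟧ ≤ ⟦ adj G c u ∧ not ⌊ u ≟ b ⌋ ⟧
    count none u with u ≟ d
    ... | yes refl rewrite ¬bd | cd | ≟-false (≢-sym b≢d) = ≤-refl
    ... | no _ with adj G b u in bu | u ≟ c
    ...   | false | _ = z≤n
    ...   | true | yes refl = z≤n
    ...   | true | no u≢c with adj G c u in cu
    ...     | true rewrite ≟-false (≢-sym (adj⇒≢ G bu)) = ≤-refl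
    ...     | false = contradiction (u , bu , cu , u≢c) none

    deg-< : ¬ ∃ Unshared → deg G b < deg G c
    deg-< none = begin-strict
      deg G b                         ≡⟨ deg-split G b c ⟩
      deg-except G b c + ⟦ adj G b c ⟧  <⟨ +-mono-<-≤ except-< (≤-reflexive (cong ⟦_⟧ (sym G b c))) ⟩
      deg-except G c b + ⟦ adj G c b ⟧  ≡⟨ deg-split G c b ⟨
      deg G c ∎
      where
      open ≤-Reasoning
      except-< : deg-except G b c < deg-except G c b
      except-< = begin-strict
        deg-except G b c
          <⟨ m<m+n (deg-except G b c) (s≤s z≤n) ⟩
        deg-except G b c + 1
          ≡⟨ cong (deg-except G b c +_) (sumFin-point d (λ _ → 1)) ⟨
        deg-except G b c + sumFin (λ u → ⟦ ⌊ u ≟ d ⌋ ⟧)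
          ≡⟨ sumFin-+ (λ u → ⟦ adj G b u ∧ not ⌊ u ≟ c ⌋ ⟧) (λ u → ⟦ ⌊ u ≟ d ⌋ ⟧) ⟨
        sumFin (λ u → ⟦ adj G b u ∧ not ⌊ u ≟ c ⌋ ⟧ + ⟦ ⌊ u ≟ d ⌋ ⟧)
          ≤⟨ sumFin-mono (count none) ⟩
        deg-except G c b ∎

  unshared-neighbour : deg G c ≤ deg G b → ∃ λ u → adj G b u ≡ true × adj G c u ≡ false × u ≢ c
  unshared-neighbour c≤b
    with any? (λ u → (adj G b u ≟ᵇ true) ×-dec (adj G c u ≟ᵇ false) ×-dec ¬? (u ≟ c))
  ... | yes found = found
  ... | no none = contradiction c≤b (<⇒≱ (deg-< none))

two-neighbours : (G : Graph n) {x u v : Fin n} → adj G x u ≡ true → adj G x v ≡ true → u ≢ v → 2 ≤ deg G x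
two-neighbours G {x} {u} {v} xu xv u≢v = begin
  2
    ≡⟨ cong₂ _+_ (sumFin-point u (λ _ → 1)) (sumFin-point v (λ _ → 1)) ⟨
  sumFin (λ j → ⟦ ⌊ j ≟ u ⌋ ⟧) + sumFin (λ j → ⟦ ⌊ j ≟ v ⌋ ⟧)
    ≡⟨ sumFin-+ (λ j → ⟦ ⌊ j ≟ u ⌋ ⟧) (λ j → ⟦ ⌊ j ≟ v ⌋ ⟧) ⟨
  sumFin (λ j → ⟦ ⌊ j ≟ u ⌋ ⟧ + ⟦ ⌊ j ≟ v ⌋ ⟧)
    ≤⟨ sumFin-mono pointwise ⟩
  deg G x ∎
  where
  open ≤-Reasoning
  pointwise : ∀ j → ⟦ ⌊ j ≟ u ⌋ ⟧ + ⟦ ⌊ j ≟ v ⌋ ⟧ ≤ ⟦ adj G x j ⟧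
  pointwise j with j ≟ u | j ≟ v
  ... | yes refl | yes refl = contradiction refl u≢v
  ... | yes refl | no _ rewrite xu = ≤-refl
  ... | no _ | yes refl rewrite xv = ≤-refl
  ... | no _ | no _ = z≤n

partner-unique : (N : PerfectMatching n) {b d u : Fin n} → E N b d ≡ true → E N b u ≡ true → u ≡ d
partner-unique N {b} {d} {u} bd bu with u ≟ d
... | yes u≡d = u≡d
... | no u≢d = contradiction (subst (2 ≤_) (regular N b) (two-neighbours (graph N) bu bd u≢d)) λ { (s≤s ()) }

module _ (N : PerfectMatching n) where

  N-edge : Fin n → Fin n → Set
  N-edge i j = E N i j ≡ true

  complete-exchange : (G : Graph n) {a b c d : Fin n} → N-edge a c → N-edge b d → E N c d ≡ false →
    adj G a c ≡ true → adj G c d ≡ true → adj G b d ≡ false → deg G c ≤ deg G b → Rewiring G N-edge a c b d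
  complete-exchange G {a} {b} {c} {d} Nac Nbd ¬Ncd Gac Gcd ¬Gbd c≤b
    with unshared-neighbour G (adj⇒≢ (graph N) Nbd) Gcd ¬Gbd c≤b
  ... | u , Gbu , ¬Gcu , u≢c = record
    { graph′ = graph′
    ; deg-same = deg-same
    ; has-pq = keeps a c Gac (kept Nac)
    ; has-rs = trans (sym graph′ b d) has-rs
    ; keeps = λ i j Gij Nij → keeps i j Gij (kept Nij)
    }
    where
    open Rewiring (switch G (≢-sym u≢c) (≢-sym (adj⇒≢ (graph N) Nbd)) Gcd (trans (sym G u b) Gbu) ¬Gcu
                          (trans (sym G d b) ¬Gbd))
    ¬Nub : E N u b ≡ false
    ¬Nub = ≢true⇒≡false λ Nub → adj-≢ G Gbu ¬Gbd (partner-unique N Nbd (trans (sym (graph N) b u) Nub))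
    kept : ∀ {i j} → N-edge i j → isEdge i j c d ≡ false × isEdge i j u b ≡ false
    kept Nij = isEdge-nonedge (graph N) Nij ¬Ncd , isEdge-nonedge (graph N) Nij ¬Nub

  rewire : (G : Graph n) {a b c d : Fin n} → N-edge a c → N-edge b d → E N a b ≡ false → E N c d ≡ false →
    adj G a b ≡ true → adj G c d ≡ true → deg G c ≤ deg G b → deg G d ≤ deg G a → Rewiring G N-edge a c b d
  rewire G {a} {b} {c} {d} Nac Nbd ¬Nab ¬Ncd Gab Gcd c≤b d≤a with adj G a c in Gac | adj G b d in Gbd
  ... | true | true =
    record { graph′ = G ; deg-same = λ _ → refl ; has-pq = Gac ; has-rs = Gbd ; keeps = λ _ _ Gij _ → Gij }
  ... | true | false = complete-exchange G Nac Nbd ¬Ncd Gac Gcd Gbd c≤b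
  ... | false | true = Rewiring-swap
    (complete-exchange G Nbd Nac (trans (sym (graph N) d c) ¬Ncd) Gbd (trans (sym G d c) Gcd) Gac d≤a)
  ... | false | false =
    Rewiring-mono (λ Nij → isEdge-nonedge (graph N) Nij ¬Nab , isEdge-nonedge (graph N) Nij ¬Ncd)
                  (switch G (adj⇒≢ (graph N) Nac) (adj⇒≢ (graph N) Nbd) Gab Gcd Gac Gbd)

module Difference (X Y : Fin n → Fin n → Bool) {T : Fin n → Fin n → Bool}
                  (difference : ∀ a b → (X a b ∧ not (Y a b)) ≡ T a b) where

  difference-edge : (i j : Fin n) → T i j ≡ true → X i j ≡ true × Y i j ≡ false
  difference-edge i j t = ∧-not-true (trans (difference i j) t)

  difference-cover : {i j : Fin n} → X i j ≡ true → Y i j ≡ true ⊎ T i j ≡ true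
  difference-cover {i} {j} x with Y i j in y
  ... | true = inj₁ refl
  ... | false = inj₂ (trans (≡-sym (difference i j)) (trans (cong (_∧ not (Y i j)) x) (cong not y)))

twoEdges-left : (i j : Fin n) {p q r s : Fin n} → isEdge i j p q ≡ true → twoEdges i j p q r s ≡ true
twoEdges-left _ _ e rewrite e = refl

twoEdges-right : (i j : Fin n) {p q r s : Fin n} → isEdge i j r s ≡ true → twoEdges i j p q r s ≡ true
twoEdges-right i j {p} {q} e rewrite e = ∨-zeroʳ (isEdge i j p q)

realize-exchange : (N M : PerfectMatching n) {a b c d : Fin n} {ds : Fin n → ℕ} →
  SwitchShape N M a b c d a c b d → ds c ≤ ds b → ds d ≤ ds a → CanRealize ds M → CanRealize ds N
realize-exchange N M {a} {b} {c} {d} (removed , added) c≤b d≤a (G , deg≡ds , M⊆G) =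
  graph′ , (λ i → trans (deg-same i) (deg≡ds i)) , N⊆graph′
  where
  open Difference (E M) (E N) removed using () renaming (difference-edge to removed-edge)
  open Difference (E N) (E M) added using () renaming (difference-edge to added-edge; difference-cover to added-cover)
  ab : E M a b ≡ true × E N a b ≡ false
  ab = removed-edge a b (twoEdges-left a b (isEdge-self a b))
  cd : E M c d ≡ true × E N c d ≡ false
  cd = removed-edge c d (twoEdges-right c d (isEdge-self c d))
  ac : E N a c ≡ true × E M a c ≡ false
  ac = added-edge a c (twoEdges-left a c (isEdge-self a c))
  bd : E N b d ≡ true × E M b d ≡ false
  bd = added-edge b d (twoEdges-right b d (isEdge-self b d))

  open Rewiring (rewire N G (proj₁ ac) (proj₁ bd) (proj₂ ab) (proj₂ cd)
                        (M⊆G a b (proj₁ ab)) (M⊆G c d (proj₁ cd))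
                        (subst₂ _≤_ (≡-sym (deg≡ds c)) (≡-sym (deg≡ds b)) c≤b)
                        (subst₂ _≤_ (≡-sym (deg≡ds d)) (≡-sym (deg≡ds a)) d≤a))

  N⊆graph′ : ∀ i j → E N i j ≡ true → adj graph′ i j ≡ true
  N⊆graph′ i j Nij with added-cover Nij
  ... | inj₁ Mij = keeps i j (M⊆G i j Mij) Nij
  ... | inj₂ new with ∨-true new
  ...   | inj₁ is-ac = trans (adj-isEdge graph′ is-ac) has-pq
  ...   | inj₂ is-bd = trans (adj-isEdge graph′ is-bd) has-rs

switch-⪯ : (N M : PerfectMatching n) {a b c d : Fin n} → SwitchShape N M a b c d a c b d →
  toℕ b < toℕ c → toℕ a < toℕ d → N ⪯ M
switch-⪯ N M shape b<c a<d ds decreasing =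
  realize-exchange N M shape (decreasing _ _ (<⇒≤ b<c)) (decreasing _ _ (<⇒≤ a<d))

weight : Fin n → Fin n → ℕ
weight u v = 2 ^ (label u + label v)

Φ : (Fin n → Fin n → Bool) → ℕ
Φ R = sumFin λ u → sumFin λ v → ⟦ R u v ∧ ⌊ toℕ u <? toℕ v ⌋ ⟧· weight u v

Φ-exchange : (R S X Y : Fin n → Fin n → Bool) →
  (∀ u v → (R u v ∧ not (S u v)) ≡ X u v) → (∀ u v → (S u v ∧ not (R u v)) ≡ Y u v) → Φ R + Φ Y ≡ Φ S + Φ X
Φ-exchange R S X Y R∖S S∖R = begin
  Φ R + Φ Y
    ≡⟨ sumFin²-+ (term R) (term Y) ⟨
  sumFin (λ u → sumFin (λ v → term R u v + term Y u v))
    ≡⟨ sumFin-cong (λ u → sumFin-cong (pointwise u)) ⟩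
  sumFin (λ u → sumFin (λ v → term S u v + term X u v))
    ≡⟨ sumFin²-+ (term S) (term X) ⟩
  Φ S + Φ X ∎
  where
  open ≡-Reasoning
  term : (Fin _ → Fin _ → Bool) → Fin _ → Fin _ → ℕ
  term T u v = ⟦ T u v ∧ ⌊ toℕ u <? toℕ v ⌋ ⟧· weight u v
  pointwise : ∀ u v → term R u v + term Y u v ≡ term S u v + term X u v
  pointwise u v rewrite ≡-sym (R∖S u v) | ≡-sym (S∖R u v) = ⟦⟧·-exchange (R u v) (S u v) _ (weight u v)

isEdge-oriented : (u v : Fin n) {p q : Fin n} → toℕ p < toℕ q →
  isEdge u v p q ∧ ⌊ toℕ u <? toℕ v ⌋ ≡ ⌊ u ≟ p ⌋ ∧ ⌊ v ≟ q ⌋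
isEdge-oriented u v p<q = ∨∧-select _ _ _ forward backward
  where
  forward : ⌊ u ≟ _ ⌋ ∧ ⌊ v ≟ _ ⌋ ≡ true → ⌊ toℕ u <? toℕ v ⌋ ≡ true
  forward e with ≟∧≟-true u v e
  ... | refl , refl = <?-true p<q
  backward : ⌊ u ≟ _ ⌋ ∧ ⌊ v ≟ _ ⌋ ≡ true → ⌊ toℕ u <? toℕ v ⌋ ≡ false
  backward e with ≟∧≟-true u v e
  ... | refl , refl = <?-false p<q

Φ-twoEdges : {p q r s : Fin n} → toℕ p < toℕ q → toℕ p < toℕ r → toℕ r < toℕ s →
  Φ (λ u v → twoEdges u v p q r s) ≡ weight p q + weight r s
Φ-twoEdges {p = p} {q} {r} {s} p<q p<r r<s = begin
  Φ (λ u v → twoEdges u v p q r s)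
    ≡⟨ sumFin-cong (λ u → sumFin-cong (split u)) ⟩
  sumFin (λ u → sumFin (λ v → ⟦ ⌊ u ≟ p ⌋ ∧ ⌊ v ≟ q ⌋ ⟧· weight u v + ⟦ ⌊ u ≟ r ⌋ ∧ ⌊ v ≟ s ⌋ ⟧· weight u v))
    ≡⟨ sumFin²-+ (λ u v → ⟦ ⌊ u ≟ p ⌋ ∧ ⌊ v ≟ q ⌋ ⟧· weight u v)
                 (λ u v → ⟦ ⌊ u ≟ r ⌋ ∧ ⌊ v ≟ s ⌋ ⟧· weight u v) ⟩
  sumFin (λ u → sumFin (λ v → ⟦ ⌊ u ≟ p ⌋ ∧ ⌊ v ≟ q ⌋ ⟧· weight u v))
    + sumFin (λ u → sumFin (λ v → ⟦ ⌊ u ≟ r ⌋ ∧ ⌊ v ≟ s ⌋ ⟧· weight u v))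
    ≡⟨ cong₂ _+_ (sumFin²-point p q weight) (sumFin²-point r s weight) ⟩
  weight p q + weight r s ∎
  where
  open ≡-Reasoning
  split : ∀ u v → ⟦ twoEdges u v p q r s ∧ ⌊ toℕ u <? toℕ v ⌋ ⟧· weight u v
                ≡ ⟦ ⌊ u ≟ p ⌋ ∧ ⌊ v ≟ q ⌋ ⟧· weight u v + ⟦ ⌊ u ≟ r ⌋ ∧ ⌊ v ≟ s ⌋ ⟧· weight u v
  split u v = trans
    (cong (⟦_⟧· weight u v) (trans (∧-distribʳ-∨ _ (isEdge u v p q) (isEdge u v r s))
                                   (cong₂ _∨_ (isEdge-oriented u v p<q) (isEdge-oriented u v r<s))))
    (⟦⟧·-∨ _ _ _ (≟∧≟-exclusive u v (<⇒≢ p<r)))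

2^-+-< : ∀ {i j m} k → i < m → j < m → 2 ^ i + 2 ^ j < 2 ^ k + 2 ^ m
2^-+-< {i} {j} {suc m} k (s≤s i≤m) (s≤s j≤m) = begin-strict
  2 ^ i + 2 ^ j      ≤⟨ +-mono-≤ (^-monoʳ-≤ 2 i≤m) (^-monoʳ-≤ 2 j≤m) ⟩
  2 ^ m + 2 ^ m      ≡⟨ cong (2 ^ m +_) (+-identityʳ (2 ^ m)) ⟨
  2 ^ suc m          <⟨ m<n+m (2 ^ suc m) (m^n>0 2 k) ⟩
  2 ^ k + 2 ^ suc m  ∎
  where open ≤-Reasoning

φ-decreases : (N M : PerfectMatching n) {p q r s p′ q′ r′ s′ : Fin n} →
  SwitchShape N M p q r s p′ q′ r′ s′ →
  toℕ p < toℕ q → toℕ p < toℕ r → toℕ r < toℕ s → toℕ p′ < toℕ q′ → toℕ p′ < toℕ r′ → toℕ r′ < toℕ s′ →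
  label p′ + label q′ < label r + label s → label r′ + label s′ < label r + label s → φ N < φ M
φ-decreases N M {p} {q} {r} {s} {p′} {q′} {r′} {s′} (removed , added)
            p<q p<r r<s p′<q′ p′<r′ r′<s′ e₁ e₂ =
  +-cancelʳ-< (Φ added-edges) (φ N) (φ M) (begin-strict
    φ N + Φ added-edges    <⟨ +-monoʳ-< (φ N) added<removed ⟩
    φ N + Φ removed-edges  ≡⟨ Φ-exchange (E M) (E N) removed-edges added-edges removed added ⟨
    φ M + Φ added-edges    ∎)
  where
  open ≤-Reasoning
  removed-edges added-edges : Fin _ → Fin _ → Bool
  removed-edges u v = twoEdges u v p q r s
  added-edges u v = twoEdges u v p′ q′ r′ s′
  added<removed : Φ added-edges < Φ removed-edges
  added<removed = begin-strict
    Φ added-edges              ≡⟨ Φ-twoEdges p′<q′ p′<r′ r′<s′ ⟩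
    weight p′ q′ + weight r′ s′ <⟨ 2^-+-< (label p + label q) e₁ e₂ ⟩
    weight p q + weight r s     ≡⟨ Φ-twoEdges p<q p<r r<s ⟨
    Φ removed-edges            ∎

twoEdges-flip : (i j p q r s : Fin n) → twoEdges i j p q r s ≡ twoEdges i j p q s r
twoEdges-flip i j p q r s = cong (isEdge i j p q ∨_) (isEdge-swap i j r s)

SwitchShape-flip-removed : (N M : PerfectMatching n) {p q r s p′ q′ r′ s′ : Fin n} →
  SwitchShape N M p q r s p′ q′ r′ s′ → SwitchShape N M p q s r p′ q′ r′ s′
SwitchShape-flip-removed _ _ {p} {q} {r} {s} (removed , added) =
  (λ i j → trans (removed i j) (twoEdges-flip i j p q r s)) , added

SwitchShape-flip-added : (N M : PerfectMatching n) {p q r s p′ q′ r′ s′ : Fin n} →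
  SwitchShape N M p q r s p′ q′ r′ s′ → SwitchShape N M p q r s p′ q′ s′ r′
SwitchShape-flip-added _ _ {p′ = p′} {q′} {r′} {s′} (removed , added) =
  removed , (λ i j → trans (added i j) (twoEdges-flip i j p′ q′ r′ s′))

parallel⇒crossing : (N M : PerfectMatching n) {w x y z : Fin n} →
  toℕ w < toℕ x → toℕ x < toℕ y → toℕ y < toℕ z →
  SwitchShape N M w x y z w y x z → (φ N < φ M) × (N ⪯ M)
parallel⇒crossing N M {z = z} w<x x<y y<z shape =
    φ-decreases N M shape w<x (<-trans w<x x<y) y<z (<-trans w<x x<y) w<x (<-trans x<y y<z)
      (+-mono-< (s≤s (<-trans w<x x<y)) (s≤s y<z)) (+-monoˡ-< (label z) (s≤s x<y))
  , switch-⪯ N M shape x<y (<-trans (<-trans w<x x<y) y<z)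

crossing⇒nested : (N M : PerfectMatching n) {w x y z : Fin n} →
  toℕ w < toℕ x → toℕ x < toℕ y → toℕ y < toℕ z →
  SwitchShape N M w y x z w z x y → (φ N < φ M) × (N ⪯ M)
crossing⇒nested N M {x = x} {z = z} w<x x<y y<z shape =
    φ-decreases N M shape (<-trans w<x x<y) w<x (<-trans x<y y<z) (<-trans w<x (<-trans x<y y<z)) w<x x<y
      (+-monoˡ-< (label z) (s≤s w<x)) (+-monoʳ-< (label x) (s≤s y<z))
  , switch-⪯ N M (SwitchShape-flip-added N M (SwitchShape-flip-removed N M shape)) y<z w<x

parallel⇒nested : (N M : PerfectMatching n) {w x y z : Fin n} →
  toℕ w < toℕ x → toℕ x < toℕ y → toℕ y < toℕ z →
  SwitchShape N M w x y z w z x y → (φ N < φ M) × (N ⪯ M)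
parallel⇒nested N M {z = z} w<x x<y y<z shape =
    φ-decreases N M shape w<x (<-trans w<x x<y) y<z (<-trans w<x (<-trans x<y y<z)) w<x x<y
      (+-monoˡ-< (label z) (s≤s (<-trans w<x x<y))) (+-mono-< (s≤s x<y) (s≤s y<z))
  , switch-⪯ N M (SwitchShape-flip-removed N M shape) (<-trans x<y y<z) (<-trans w<x x<y)

lemma10 : (n : ℕ) → n % 2 ≡ 0 → (N M : PerfectMatching n) → IsSwitch N M → (φ N < φ M) × (N ⪯ M)
lemma10 _ _ N M (_ , _ , _ , _ , w<x , x<y , y<z , inj₁ shape) = parallel⇒crossing N M w<x x<y y<z shape
lemma10 _ _ N M (_ , _ , _ , _ , w<x , x<y , y<z , inj₂ (inj₁ shape)) = crossing⇒nested N M w<x x<y y<z shape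
lemma10 _ _ N M (_ , _ , _ , _ , w<x , x<y , y<z , inj₂ (inj₂ shape)) = parallel⇒nested N M w<x x<y y<z shape
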